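{- For every integer $b\ge 1$, the state graph for $b$ balls is isomorphic (as a directed graph) to the induced subgraph of the state graph for $b+1$ balls on the set of states whose first entry is $1$.
   Context: For an integer $b\ge 1$, the state graph for $b$ balls is the infinite directed graph whose vertices (states) are the infinite $0$-$1$ sequences $\mathbf{c}=\langle c_1,c_2,\ldots\rangle$ (indexed by positive integers) containing exactly $b$ entries equal to $1$, with a directed edge $\mathbf{c}\to\mathbf{d}$ if and only if $d_i\ge c_{i+1}$ for all $i\ge 1$ (loops allowed). -}

module Defs where

open import Data.Nat using (ℕ; zero; suc; _+_; _≤_)
open import Data.Bool using (Bool; true; false; if_then_else_)
import Data.Bool as B
open import Data.Product using (Σ; ∃; _×_; _,_; proj₁)
open import Relation.Binary.PropositionalEquality using (_≡_)
open import Function.Bundles using (_⇔_)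
open import Level using (Level; _⊔_)

-- A 0-1 sequence ⟨c₁, c₂, …⟩; index i : ℕ stands for position i+1
-- (true = 1, false = 0).
Seq : Set
Seq = ℕ → Bool

count : Seq → ℕ → ℕ
count c zero = zero
count c (suc n) = (if c n then 1 else 0) + count c n

ExactlyOnes : ℕ → Seq → Set
ExactlyOnes b c = ∃ λ N → (∀ i → N ≤ i → c i ≡ false) × count c N ≡ b

State : ℕ → Set
State b = Σ Seq (ExactlyOnes b)

_≈ₛ_ : ∀ {b} → State b → State b → Set
c ≈ₛ d = ∀ i → proj₁ c i ≡ proj₁ d i

Edge : ∀ {b} → State b → State b → Set
Edge c d = ∀ i → proj₁ c (suc i) B.≤ proj₁ d i

FirstOne : ℕ → Set
FirstOne b = Σ (State b) (λ c → proj₁ c 0 ≡ true)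

_≈₁_ : ∀ {b} → FirstOne b → FirstOne b → Set
c ≈₁ d = proj₁ c ≈ₛ proj₁ d

Edge₁ : ∀ {b} → FirstOne b → FirstOne b → Set
Edge₁ c d = Edge (proj₁ c) (proj₁ d)

record DiGraphIso {a b e f r s : Level}
    (V : Set a) (_≈V_ : V → V → Set e) (E : V → V → Set r)
    (W : Set b) (_≈W_ : W → W → Set f) (F : W → W → Set s)
    : Set (a ⊔ b ⊔ e ⊔ f ⊔ r ⊔ s) where
  field
    to       : V → W
    from     : W → V
    to-cong  : ∀ {x y} → x ≈V y → to x ≈W to y
    from-cong : ∀ {x y} → x ≈W y → from x ≈V from y
    from-to  : ∀ x → from (to x) ≈V x
    to-from  : ∀ y → to (from y) ≈W y
    edge     : ∀ x y → E x y ⇔ F (to x) (to y)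

-- Prepending a 1 turns a b-ball state into a (b+1)-ball state with first
-- entry 1, and dropping the first entry undoes this. The edge condition
-- d_i ≥ c_{i+1} for the extended states is automatic at i = 1, since the
-- new d_1 is 1, and at i + 1 it is exactly the old condition at i.
module Submission where

open import Defs
open import Data.Nat using (ℕ; zero; suc; _+_; _≤_; s≤s)
open import Data.Nat.Properties using (suc-injective; +-commutativeSemigroup)
open import Data.Bool using (Bool; true; false; if_then_else_)
import Data.Bool as B
open import Data.Bool.Properties using (≤-maximum)
open import Data.Product using (_,_; proj₁)
open import Relation.Binary.PropositionalEquality using (_≡_; refl; sym; cong; trans; module ≡-Reasoning)
open import Function.Bundles using (_⇔_; mk⇔)
open import Algebra.Properties.CommutativeSemigroup +-commutativeSemigroup using (x∙yz≈y∙xz)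

infixr 5 _◂_

_◂_ : Bool → Seq → Seq
(x ◂ c) zero    = x
(x ◂ c) (suc i) = c i

tail : Seq → Seq
tail d i = d (suc i)

count-suc : ∀ d n → count d (suc n) ≡ (if d 0 then 1 else 0) + count (tail d) n
count-suc d zero    = refl
count-suc d (suc n) = begin
  dₙ + count d (suc n)          ≡⟨ cong (dₙ +_) (count-suc d n) ⟩
  dₙ + (d₀ + count (tail d) n)  ≡⟨ x∙yz≈y∙xz dₙ d₀ _ ⟩
  d₀ + (dₙ + count (tail d) n)  ∎
  where
  open ≡-Reasoning
  dₙ d₀ : ℕ
  dₙ = if d (suc n) then 1 else 0
  d₀ = if d 0 then 1 else 0

ExactlyOnes-◂ : ∀ {b c} x → ExactlyOnes b c → ExactlyOnes ((if x then 1 else 0) + b) (x ◂ c)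
ExactlyOnes-◂ {c = c} x (N , zeros , ones) =
  suc N , zerosFrom , trans (count-suc (x ◂ c) N) (cong ((if x then 1 else 0) +_) ones)
  where
  zerosFrom : ∀ i → suc N ≤ i → (x ◂ c) i ≡ false
  zerosFrom (suc i) (s≤s N≤i) = zeros i N≤i

ExactlyOnes-tail : ∀ {b d} → d 0 ≡ true → ExactlyOnes (suc b) d → ExactlyOnes b (tail d)
ExactlyOnes-tail {d = d} d₀ (suc N , zeros , ones) =
  N , (λ i N≤i → zeros (suc i) (s≤s N≤i)) , suc-injective (begin
    suc (count (tail d) N)                      ≡⟨ cong (λ x → (if x then 1 else 0) + count (tail d) N) (sym d₀) ⟩
    (if d 0 then 1 else 0) + count (tail d) N   ≡⟨ sym (count-suc d N) ⟩
    count d (suc N)                             ≡⟨ ones ⟩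
    suc _                                       ∎)
  where open ≡-Reasoning

prependOne : ∀ {b} → State b → FirstOne (suc b)
prependOne (c , c-ones) = (true ◂ c , ExactlyOnes-◂ true c-ones) , refl

dropFirst : ∀ {b} → FirstOne (suc b) → State b
dropFirst ((d , d-ones) , d₀) = tail d , ExactlyOnes-tail d₀ d-ones

edge-prependOne : ∀ c d →
  (∀ i → c (suc i) B.≤ d i) ⇔ (∀ i → (true ◂ c) (suc i) B.≤ (true ◂ d) i)
edge-prependOne c d = mk⇔ extend (λ e i → e (suc i))
  where
  extend : (∀ i → c (suc i) B.≤ d i) → ∀ i → (true ◂ c) (suc i) B.≤ (true ◂ d) i
  extend e zero    = ≤-maximum (c 0)
  extend e (suc i) = e i

theorem5p2 : ∀ (b : ℕ) → 1 ≤ b →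
    DiGraphIso (State b) (_≈ₛ_ {b}) (Edge {b})
    (FirstOne (suc b)) (_≈₁_ {suc b}) (Edge₁ {suc b})
theorem5p2 b _ = record
  { to        = prependOne
  ; from      = dropFirst
  ; to-cong   = λ c≈d → λ { zero → refl ; (suc i) → c≈d i }
  ; from-cong = λ c≈d i → c≈d (suc i)
  ; from-to   = λ c i → refl
  ; to-from   = λ { ((d , _) , d₀) zero → sym d₀ ; _ (suc i) → refl }
  ; edge      = λ c d → edge-prependOne (proj₁ c) (proj₁ d)
  }
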